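{- For every integer $n\ge4$, there exists a set $Q$ of quartets with $|\mathcal{L}(Q)|=n$ and a label $\ell\in\mathcal{L}(Q)$ such that (1) every $q\in Q$ has a leaf labeled $\ell$, (2) $Q$ is incompatible, (3) every proper subset of $Q$ is compatible, and (4) $|Q|=n-2$.
   Context: A quartet is a binary unrooted phylogenetic tree (tree with no degree-two vertex, every internal vertex of degree three, leaves bijectively labeled) with four leaves; $ab|cd$ denotes the quartet on $\{a,b,c,d\}$ in which the path between $a$ and $b$ is disjoint from the path between $c$ and $d$. $\mathcal{L}(Q)$ is the union of the label sets of the quartets in $Q$. A tree $T$ displays a tree $T'$ if $T'$ is obtained from the restriction $T|\mathcal{L}(T')$ (minimal subtree spanning the leaves labeled by $\mathcal{L}(T')$, with degree-two vertices suppressed) by contracting edges. A set of quartets is compatible if some unrooted phylogenetic tree displays all of them, and incompatible otherwise. -}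

module Defs where

open import Data.Nat using (ℕ; _∸_)
open import Data.Fin using (Fin)
open import Data.Bool using (Bool; true; false)
open import Data.List using (List; []; _∷_; length; filterᵇ; allFin)
open import Data.List.Membership.Propositional using (_∈_)
open import Data.List.Relation.Unary.Unique.Propositional using (Unique)
open import Data.Product using (Σ; ∃; _×_; _,_)
open import Data.Sum using (_⊎_)
open import Data.Empty using (⊥)
open import Relation.Nullary using (¬_)
open import Relation.Binary.PropositionalEquality using (_≡_)

module _ {m : ℕ} (adj : Fin m → Fin m → Bool) where

  data Walk : Fin m → Fin m → List (Fin m) → Set where
    here : ∀ {v} → Walk v v (v ∷ [])
    step : ∀ {u w v p} → adj u w ≡ true → Walk w v p → Walk u v (u ∷ p)

  IsPath : Fin m → Fin m → List (Fin m) → Set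
  IsPath u v p = Walk u v p × Unique p

  degree : Fin m → ℕ
  degree v = length (filterᵇ (adj v) (allFin m))

record PhyloTree (n : ℕ) : Set where
  field
    m          : ℕ
    adj        : Fin m → Fin m → Bool
    adj-sym    : ∀ u v → adj u v ≡ adj v u
    adj-irrefl : ∀ v → adj v v ≡ false
    connected  : ∀ u v → ∃ λ p → IsPath adj u v p
    uniquePath : ∀ u v p q → IsPath adj u v p → IsPath adj u v q → p ≡ q
    noDeg2     : ∀ v → ¬ (degree adj v ≡ 2)
    leaf       : Fin n → Fin m
    leaf-inj   : ∀ x y → leaf x ≡ leaf y → x ≡ y
    leaf-deg   : ∀ x → degree adj (leaf x) ≡ 1
    leaf-surj  : ∀ v → degree adj v ≡ 1 → ∃ λ x → leaf x ≡ v

record Quartet (n : ℕ) : Set where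
  constructor _∣∣_∣∣_∣∣_   -- ab|cd written  a ∣∣ b ∣∣ c ∣∣ d
  field
    a b c d : Fin n
    a≢b : ¬ a ≡ b
    a≢c : ¬ a ≡ c
    a≢d : ¬ a ≡ d
    b≢c : ¬ b ≡ c
    b≢d : ¬ b ≡ d
    c≢d : ¬ c ≡ d

open Quartet public

_∈ℒ_ : ∀ {n} → Fin n → Quartet n → Set
x ∈ℒ q = x ≡ a q ⊎ x ≡ b q ⊎ x ≡ c q ⊎ x ≡ d q

-- equality of quartets as trees: ab|cd = ba|cd = ab|dc = cd|ab = ...
SamePair : ∀ {n} → Fin n → Fin n → Fin n → Fin n → Set
SamePair x y x' y' = (x ≡ x' × y ≡ y') ⊎ (x ≡ y' × y ≡ x')

SameQuartet : ∀ {n} → Quartet n → Quartet n → Set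
SameQuartet q q' =
  (SamePair (a q) (b q) (a q') (b q') × SamePair (c q) (d q) (c q') (d q'))
  ⊎ (SamePair (a q) (b q) (c q') (d q') × SamePair (c q) (d q) (a q') (b q'))

-- T displays ab|cd: T restricted to {a,b,c,d} is the quartet ab|cd, i.e.
-- the path between the leaves a and b is vertex-disjoint from the path
-- between the leaves c and d.
Displays : ∀ {n} → PhyloTree n → Quartet n → Set
Displays T q =
  Σ (List (Fin m)) λ p → Σ (List (Fin m)) λ p' →
    IsPath adj (leaf (a q)) (leaf (b q)) p ×
    IsPath adj (leaf (c q)) (leaf (d q)) p' ×
    (∀ v → v ∈ p → v ∈ p' → ⊥)
  where open PhyloTree T

Compatible : ∀ {n} → (Quartet n → Set) → Set
Compatible {n} S = Σ (PhyloTree n) λ T → ∀ q → S q → Displays T q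

{-# OPTIONS --safe #-}
module Submission where

-- With chain labels c₀, …, c_{K+1} and two more labels z, ℓ (so n = K + 4), take the K + 1 links
-- cⱼ c_{j+1} | z ℓ together with the star c₀ z | c_{K+1} ℓ.  In a tree, ab|cd and be|cd force ae|cd,
-- so the links force c₀ c_{K+1} | z ℓ, which is incompatible with the star.  Conversely a caterpillar
-- displays ab|cd whenever a and b both precede c and d in its leaf order, so dropping the star is
-- witnessed by the order c₀ … c_{K+1} z ℓ and dropping the i-th link by c₀ … cᵢ z ℓ c_{i+1} … c_{K+1}.

open import Defs
open import Data.Nat using (ℕ; _≤_; _∸_)
open import Data.Fin using (Fin)
open import Data.List using (List; length)
open import Data.List.Membership.Propositional using (_∈_)
open import Data.List.Relation.Unary.AllPairs using (AllPairs)
open import Data.Product using (Σ; ∃; _×_)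
open import Relation.Nullary using (¬_)
open import Relation.Binary.PropositionalEquality using (_≡_)

open import Data.Bool using (Bool; true; false)
open import Data.Bool.Properties using (T-≡)
open import Data.Empty using (⊥; ⊥-elim)
open import Data.Fin using (zero; suc; _↑ˡ_; _↑ʳ_; splitAt; toℕ; inject₁; fromℕ; fromℕ<)
open import Data.Fin.Induction using (<-weakInduction)
open import Data.Fin.Permutation using (Permutation′; permutation; _⟨$⟩ʳ_; _⟨$⟩ˡ_; inverseˡ; inverseʳ)
open import Data.Fin.Properties using (_≟_)
import Data.Fin.Properties as Fin
open import Data.List using ([]; _∷_; _∷ʳ_; map; reverse; filterᵇ; allFin; tabulate)
open import Data.List.Properties using (unfold-reverse; reverse-injective; length-tabulate)
open import Data.List.Membership.Propositional using (_∉_)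
open import Data.List.Membership.Propositional.Properties
  using (∈-++⁻; ∈-map⁻; ∈-filter⁺; ∈-filter⁻; ∈-allFin; ∈-length; ∈-tabulate⁺; ∈-tabulate⁻)
open import Data.List.Membership.DecPropositional using () renaming (_∈?_ to ∈?)
open import Data.List.Relation.Binary.Subset.Propositional using (_⊆_)
open import Data.List.Relation.Binary.Permutation.Propositional using (↭-sym; ↭⇒↭ₛ)
open import Data.List.Relation.Binary.Permutation.Propositional.Properties using (↭-reverse)
import Data.List.Relation.Binary.Permutation.Setoid.Properties as Perm
open import Data.List.Relation.Unary.All using ([]; _∷_)
import Data.List.Relation.Unary.All.Properties as All
open import Data.List.Relation.Unary.All.Properties.Core using (¬Any⇒All¬; All¬⇒¬Any)
open import Data.List.Relation.Unary.AllPairs using ([]; _∷_)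
import Data.List.Relation.Unary.AllPairs.Properties as AllPairs
open import Data.List.Relation.Unary.Any using (here; there)
import Data.List.Relation.Unary.Any.Properties as Any
open import Data.List.Relation.Unary.Unique.Propositional using (Unique)
import Data.List.Relation.Unary.Unique.Propositional.Properties as Unique
import Data.Nat.Properties as ℕ
open import Data.Nat using (suc; zero; _+_; z≤n; s≤s; _<_; _⊔_; _⊓_)
open import Data.Product using (_,_; proj₁; proj₂) renaming (map to map-×)
open import Data.Sum using (_⊎_; inj₁; inj₂; map₁)
open import Function using (_∘_)
open import Function.Bundles using (Equivalence)
open import Relation.Binary.Definitions using (tri<; tri≈; tri>)
open import Relation.Binary.PropositionalEquality
  using (refl; sym; trans; cong; cong₂; subst; setoid; module ≡-Reasoning)
open import Relation.Nullary using (Dec; yes; no; does)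
open import Relation.Nullary.Decidable using (dec-true; T?)

private
  variable
    A : Set
    x : A
    xs : List A

Unique-∷ : x ∉ xs → Unique xs → Unique (x ∷ xs)
Unique-∷ {xs = xs} x∉xs u = ¬Any⇒All¬ xs x∉xs ∷ u

Unique-∷⇒∉ : Unique (x ∷ xs) → x ∉ xs
Unique-∷⇒∉ (x≢xs ∷ _) = All¬⇒¬Any x≢xs

Unique-reverse : Unique xs → Unique (reverse xs)
Unique-reverse {xs = xs} = Perm.Unique-resp-↭ (setoid _) (↭⇒↭ₛ (↭-sym (↭-reverse xs)))

module _ {m : ℕ} (adj : Fin m → Fin m → Bool) where

  start∈ : ∀ {u v p} → Walk adj u v p → u ∈ p
  start∈ here = here refl
  start∈ (step _ _) = here refl

  end∈ : ∀ {u v p} → Walk adj u v p → v ∈ p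
  end∈ here = here refl
  end∈ (step _ w) = there (end∈ w)

  walk-∷ʳ : ∀ {u v w p} → Walk adj u v p → adj v w ≡ true → Walk adj u w (p ∷ʳ w)
  walk-∷ʳ here e = step e here
  walk-∷ʳ (step e′ r) e = step e′ (walk-∷ʳ r e)

  walk-reverse : (∀ u v → adj u v ≡ adj v u) → ∀ {u v p} → Walk adj u v p → Walk adj v u (reverse p)
  walk-reverse adj-sym here = here
  walk-reverse adj-sym (step {u} {w} {p = p} e r) rewrite unfold-reverse u p =
    walk-∷ʳ (walk-reverse adj-sym r) (trans (adj-sym w u) e)

  path-reverse : (∀ u v → adj u v ≡ adj v u) → ∀ {u v p} → IsPath adj u v p → IsPath adj v u (reverse p)
  path-reverse adj-sym (w , u) = walk-reverse adj-sym w , Unique-reverse u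

  walk-join : ∀ {u v w p q} → Walk adj u v p → Walk adj v w q →
              ∃ λ r → Walk adj u w r × (∀ {y} → y ∈ r → y ∈ p ⊎ y ∈ q)
  walk-join here wq = _ , wq , inj₂
  walk-join (step e r) wq with walk-join r wq
  ... | s , ws , s⊆ = _ , step e ws , λ
    { (here y≡u) → inj₁ (here y≡u)
    ; (there y∈s) → map₁ there (s⊆ y∈s) }

  path-suffix : ∀ {u v p x} → IsPath adj u v p → x ∈ p → ∃ λ s → IsPath adj x v s × s ⊆ p
  path-suffix P@(here , _) (here refl) = _ , P , λ y∈ → y∈
  path-suffix P@(step _ _ , _) (here refl) = _ , P , λ y∈ → y∈
  path-suffix (step _ r , _ ∷ u) (there x∈) with path-suffix (r , u) x∈
  ... | s , S , s⊆ = s , S , λ y∈ → there (s⊆ y∈)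

  walk⇒path : ∀ {u v p} → Walk adj u v p → ∃ λ q → IsPath adj u v q × q ⊆ p
  walk⇒path here = _ , (here , [] ∷ []) , λ y∈ → y∈
  walk⇒path (step {u} e r) with walk⇒path r
  ... | q , Q , q⊆ with ∈? _≟_ u q
  ...   | yes u∈q = let s , S , s⊆ = path-suffix Q u∈q in s , S , λ y∈ → there (q⊆ (s⊆ y∈))
  ...   | no u∉q = u ∷ q , (step e (proj₁ Q) , Unique-∷ u∉q (proj₂ Q)) ,
                   λ { (here y≡u) → here y≡u ; (there y∈) → there (q⊆ y∈) }

  walk-exit : ∀ {u v p} (X : Fin m → Set) → (∀ x → Dec (X x)) → Walk adj u v p → X u → ¬ X v →
              ∃ λ x → ∃ λ y → x ∈ p × y ∈ p × adj x y ≡ true × X x × ¬ X y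
  walk-exit X X? here Xu ¬Xv = ⊥-elim (¬Xv Xu)
  walk-exit X X? (step {w = w} e r) Xu ¬Xv with X? w
  ... | no ¬Xw = _ , w , here refl , there (start∈ r) , e , Xu , ¬Xw
  ... | yes Xw with walk-exit X X? r Xw ¬Xv
  ...   | x , y , x∈ , y∈ , exy , Xx , ¬Xy = x , y , there x∈ , there y∈ , exy , Xx , ¬Xy

record IsTree {m : ℕ} (adj : Fin m → Fin m → Bool) : Set where
  field
    adj-sym    : ∀ u v → adj u v ≡ adj v u
    adj-irrefl : ∀ v → adj v v ≡ false
    connected  : ∀ u v → ∃ λ p → IsPath adj u v p
    uniquePath : ∀ u v p q → IsPath adj u v p → IsPath adj u v q → p ≡ q

Separated : ∀ {m} → (Fin m → Fin m → Bool) → Fin m → Fin m → Fin m → Fin m → Set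
Separated {m} adj a b c d = Σ (List (Fin m)) λ p → Σ (List (Fin m)) λ p′ →
  IsPath adj a b p × IsPath adj c d p′ × (∀ v → v ∈ p → v ∈ p′ → ⊥)

separated-sym : ∀ {m} {adj : Fin m → Fin m → Bool} {a b c d} →
                Separated adj a b c d → Separated adj c d a b
separated-sym (p , p′ , P , P′ , p#p′) = p′ , p , P′ , P , λ v v∈p′ v∈p → p#p′ v v∈p v∈p′

PhyloTree⇒IsTree : ∀ {n} (T : PhyloTree n) → IsTree (PhyloTree.adj T)
PhyloTree⇒IsTree T = record
  { adj-sym = adj-sym ; adj-irrefl = adj-irrefl ; connected = connected ; uniquePath = uniquePath }
  where open PhyloTree T

swapSides : ∀ {n} → Quartet n → Quartet n
swapSides q = record
  { a = c q ; b = d q ; c = a q ; d = b q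
  ; a≢b = c≢d q ; a≢c = a≢c q ∘ sym ; a≢d = b≢c q ∘ sym
  ; b≢c = a≢d q ∘ sym ; b≢d = b≢d q ∘ sym ; c≢d = a≢b q
  }

displays-swapSides : ∀ {n} (T : PhyloTree n) q → Displays T (swapSides q) → Displays T q
displays-swapSides T q = separated-sym

module TreeProperties {m : ℕ} {adj : Fin m → Fin m → Bool} (tree : IsTree adj) where
  open IsTree tree

  path⊆walk : ∀ {u v p w} → IsPath adj u v p → Walk adj u v w → p ⊆ w
  path⊆walk P W with walk⇒path adj W
  ... | q , Q , q⊆w = λ y∈p → q⊆w (subst (_ ∈_) (uniquePath _ _ _ _ P Q) y∈p)

  path⊆∪ : ∀ {u v w r p q y} → IsPath adj u w r → Walk adj u v p → Walk adj v w q →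
           y ∈ r → y ∈ p ⊎ y ∈ q
  path⊆∪ R Wp Wq y∈r with walk-join adj Wp Wq
  ... | s , Ws , s⊆ = s⊆ (path⊆walk R Ws y∈r)

  -- u followed by the path from w is a path to b, so by uniqueness it is the suffix of P from u.
  neighbour∈path : ∀ {x y b u w p q} → IsPath adj x b p → u ∈ p → adj u w ≡ true →
                   IsPath adj y b q → w ∈ q → u ∉ q → w ∈ p
  neighbour∈path P u∈p uw Q w∈q u∉q with path-suffix adj P u∈p | path-suffix adj Q w∈q
  ... | s , S , s⊆p | s′ , (Ws′ , Us′) , s′⊆q =
    s⊆p (subst (_ ∈_) (uniquePath _ _ _ _ (step uw Ws′ , Unique-∷ (λ u∈s′ → u∉q (s′⊆q u∈s′)) Us′) S)
                      (there (start∈ adj Ws′)))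

  separated-trans : ∀ {a b c d e} → Separated adj a b c d → Separated adj b e c d → Separated adj a e c d
  separated-trans {a} {e = e} (p , p′ , (Wp , _) , P′ , p#p′) (q , q′ , (Wq , _) , Q′ , q#q′)
    with connected a e
  ... | r , R = r , p′ , R , P′ , λ v v∈r v∈p′ → avoid v∈p′ (path⊆∪ R Wp Wq v∈r)
    where
    avoid : ∀ {v} → v ∈ p′ → v ∈ p ⊎ v ∈ q → ⊥
    avoid v∈p′ (inj₁ v∈p) = p#p′ _ v∈p v∈p′
    avoid v∈p′ (inj₂ v∈q) = q#q′ _ v∈q (subst (_ ∈_) (uniquePath _ _ _ _ P′ Q′) v∈p′)

  -- Leave the path ab along the path ad: the first edge uw out of it has w on bd but u not.
  separated⇒¬crossed : ∀ {a b c d} → Separated adj a b c d → ¬ Separated adj a c b d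
  separated⇒¬crossed {a} {d = d} (pab , pcd , Pab , Pcd , ab#cd) (pac , pbd , Pac , Pbd , ac#bd)
    with connected a d
  ... | pad , Pad
    with walk-exit adj (_∈ pab) (λ v → ∈? _≟_ v pab) (proj₁ Pad) (start∈ adj (proj₁ Pab))
                   (λ d∈ab → ab#cd d d∈ab (end∈ adj (proj₁ Pcd)))
  ... | u , w , u∈ad , w∈ad , uw , u∈ab , w∉ab =
    w∉ab (neighbour∈path Pab u∈ab uw (path-reverse adj adj-sym Pbd) (Any.reverse⁺ w∈bd)
                         (λ u∈db → u∉bd (Any.reverse⁻ u∈db)))
    where
    w∈bd : w ∈ pbd
    w∈bd with path⊆∪ Pad (proj₁ Pab) (proj₁ Pbd) w∈ad
    ... | inj₁ w∈ab = ⊥-elim (w∉ab w∈ab)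
    ... | inj₂ w∈bd = w∈bd
    u∉bd : u ∉ pbd
    u∉bd u∈bd with path⊆∪ Pad (proj₁ Pac) (proj₁ Pcd) u∈ad
    ... | inj₁ u∈ac = ac#bd u u∈ac u∈bd
    ... | inj₂ u∈cd = ab#cd u u∈ab u∈cd

≟-true⇒≡ : ∀ {m} {u v : Fin m} → does (u ≟ v) ≡ true → u ≡ v
≟-true⇒≡ {u = u} {v} e with u ≟ v
... | yes u≡v = u≡v

zero∉map-suc : ∀ {m} (p : List (Fin m)) → Fin.zero ∉ map suc p
zero∉map-suc (_ ∷ p) (there 0∈p) = zero∉map-suc p 0∈p

pendant : ∀ {m} → (Fin m → Fin m → Bool) → Fin m → Fin (suc m) → Fin (suc m) → Bool
pendant adj y zero    zero    = false
pendant adj y zero    (suc v) = does (v ≟ y)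
pendant adj y (suc u) zero    = does (u ≟ y)
pendant adj y (suc u) (suc v) = adj u v

module _ {m : ℕ} (adj : Fin m → Fin m → Bool) (y : Fin m) where

  pendant-walk : ∀ {u v p} → Walk adj u v p → Walk (pendant adj y) (suc u) (suc v) (map suc p)
  pendant-walk here = here
  pendant-walk (step e r) = step e (pendant-walk r)

  pendant-path : ∀ {u v p} → IsPath adj u v p → IsPath (pendant adj y) (suc u) (suc v) (map suc p)
  pendant-path (W , U) = pendant-walk W , Unique.map⁺ Fin.suc-injective U

  pendant-path-new : ∀ {v p} → IsPath adj y v p → IsPath (pendant adj y) zero (suc v) (zero ∷ map suc p)
  pendant-path-new {p = p} P =
    step (dec-true (y ≟ y) refl) (proj₁ (pendant-path P)) ,
    Unique-∷ (zero∉map-suc p) (proj₂ (pendant-path P))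

  pendant-walk⁻ : ∀ {u v p} → Walk (pendant adj y) (suc u) (suc v) p → Unique p →
                  ∃ λ p₀ → p ≡ map suc p₀ × Walk adj u v p₀
  pendant-walk⁻ here _ = _ , refl , here
  pendant-walk⁻ (step {w = zero} _ (step {w = zero} () _)) _
  pendant-walk⁻ (step {w = zero} u~0 (step {w = suc w} {p = p} 0~w r)) U =
    ⊥-elim (Unique-∷⇒∉ U (there (subst (_∈ p) (cong suc (trans (≟-true⇒≡ 0~w) (sym (≟-true⇒≡ u~0))))
                                          (start∈ _ r))))
  pendant-walk⁻ (step {w = suc w} e r) (_ ∷ U) with pendant-walk⁻ r U
  ... | p₀ , refl , W₀ = _ , refl , step e W₀

  pendant-isTree : IsTree adj → IsTree (pendant adj y)
  pendant-isTree tree = record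
    { adj-sym = adj-sym′ ; adj-irrefl = adj-irrefl′ ; connected = connected′ ; uniquePath = uniquePath′ }
    where
    open IsTree tree
    adj′ : Fin (suc m) → Fin (suc m) → Bool
    adj′ = pendant adj y

    adj-sym′ : ∀ u v → adj′ u v ≡ adj′ v u
    adj-sym′ zero    zero    = refl
    adj-sym′ zero    (suc v) = refl
    adj-sym′ (suc u) zero    = refl
    adj-sym′ (suc u) (suc v) = adj-sym u v

    adj-irrefl′ : ∀ v → adj′ v v ≡ false
    adj-irrefl′ zero    = refl
    adj-irrefl′ (suc v) = adj-irrefl v

    connected-new : ∀ v → ∃ λ p → IsPath adj′ zero (suc v) p
    connected-new v = _ , pendant-path-new (proj₂ (connected y v))

    connected′ : ∀ u v → ∃ λ p → IsPath adj′ u v p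
    connected′ zero    zero    = _ , here , [] ∷ []
    connected′ zero    (suc v) = connected-new v
    connected′ (suc u) zero    = _ , path-reverse adj′ adj-sym′ (proj₂ (connected-new u))
    connected′ (suc u) (suc v) = _ , pendant-path (proj₂ (connected u v))

    unique-old : ∀ u v p q → IsPath adj′ (suc u) (suc v) p → IsPath adj′ (suc u) (suc v) q → p ≡ q
    unique-old u v p q (Wp , Up) (Wq , Uq) with pendant-walk⁻ Wp Up | pendant-walk⁻ Wq Uq
    ... | p₀ , refl , Wp₀ | q₀ , refl , Wq₀ =
      cong (map suc) (uniquePath u v p₀ q₀ (Wp₀ , Unique.map⁻ Up) (Wq₀ , Unique.map⁻ Uq))

    unique-new : ∀ v p q → IsPath adj′ zero (suc v) p → IsPath adj′ zero (suc v) q → p ≡ q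
    unique-new v _ _ (step {w = suc w} e r , _ ∷ Up) (step {w = suc w′} e′ r′ , _ ∷ Uq)
      with ≟-true⇒≡ {u = w} e | ≟-true⇒≡ {u = w′} e′
    ... | refl | refl = cong (zero ∷_) (unique-old y v _ _ (r , Up) (r′ , Uq))

    uniquePath′ : ∀ u v p q → IsPath adj′ u v p → IsPath adj′ u v q → p ≡ q
    uniquePath′ zero    zero    _ _ (here , _) (here , _) = refl
    uniquePath′ zero    zero    _ _ (step _ r , U) _ = ⊥-elim (Unique-∷⇒∉ U (end∈ adj′ r))
    uniquePath′ zero    zero    _ _ _ (step _ r , U) = ⊥-elim (Unique-∷⇒∉ U (end∈ adj′ r))
    uniquePath′ zero    (suc v) p q P Q = unique-new v p q P Q
    uniquePath′ (suc u) (suc v) p q P Q = unique-old u v p q P Q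
    uniquePath′ (suc u) zero    p q P Q = reverse-injective
      (unique-new u (reverse p) (reverse q) (path-reverse adj′ adj-sym′ P) (path-reverse adj′ adj-sym′ Q))

2≤length : ∀ {x y : A} {xs} → x ∈ xs → y ∈ xs → ¬ x ≡ y → 2 ≤ length xs
2≤length (here refl) (here refl) x≢y = ⊥-elim (x≢y refl)
2≤length (here refl) (there y∈)  _   = s≤s (∈-length y∈)
2≤length (there x∈)  (here refl) _   = s≤s (∈-length x∈)
2≤length (there x∈)  (there y∈)  x≢y = ℕ.m≤n⇒m≤1+n (2≤length x∈ y∈ x≢y)

3≤length : ∀ {x y z : A} {xs} → x ∈ xs → y ∈ xs → z ∈ xs →
           ¬ x ≡ y → ¬ x ≡ z → ¬ y ≡ z → 3 ≤ length xs
3≤length (here refl) (here refl) _           x≢y _   _   = ⊥-elim (x≢y refl)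
3≤length (here refl) _           (here refl) _   x≢z _   = ⊥-elim (x≢z refl)
3≤length _           (here refl) (here refl) _   _   y≢z = ⊥-elim (y≢z refl)
3≤length (here refl) (there y∈)  (there z∈)  _   _   y≢z = s≤s (2≤length y∈ z∈ y≢z)
3≤length (there x∈)  (here refl) (there z∈)  _   x≢z _   = s≤s (2≤length x∈ z∈ x≢z)
3≤length (there x∈)  (there y∈)  (here refl) x≢y _   _   = s≤s (2≤length x∈ y∈ x≢y)
3≤length (there x∈)  (there y∈)  (there z∈)  x≢y x≢z y≢z = ℕ.m≤n⇒m≤1+n (3≤length x∈ y∈ z∈ x≢y x≢z y≢z)

length≡1 : ∀ {w : A} {xs} → w ∈ xs → Unique xs → (∀ {u} → u ∈ xs → u ≡ w) → length xs ≡ 1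
length≡1 {xs = _ ∷ []}    _ _               _    = refl
length≡1 {xs = x ∷ y ∷ _} _ ((x≢y ∷ _) ∷ _) only = ⊥-elim (x≢y (trans (only (here refl)) (sym (only (there (here refl))))))

module _ {m : ℕ} (adj : Fin m → Fin m → Bool) where

  private
    neighbour∈ : ∀ {v w} → adj v w ≡ true → w ∈ filterᵇ (adj v) (allFin m)
    neighbour∈ {v} {w} e = ∈-filter⁺ (T? ∘ adj v) (∈-allFin w) (Equivalence.from T-≡ e)

  degree≡1 : ∀ {v w} → adj v w ≡ true → (∀ {u} → adj v u ≡ true → u ≡ w) → degree adj v ≡ 1
  degree≡1 {v} e only = length≡1 (neighbour∈ e) (Unique.filter⁺ (T? ∘ adj v) (Unique.allFin⁺ m))
    (λ u∈ → only (Equivalence.to T-≡ (proj₂ (∈-filter⁻ (T? ∘ adj v) {xs = allFin m} u∈))))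

  3≤degree : ∀ v x y z → adj v x ≡ true → adj v y ≡ true → adj v z ≡ true →
             ¬ x ≡ y → ¬ x ≡ z → ¬ y ≡ z → 3 ≤ degree adj v
  3≤degree _ _ _ _ ex ey ez = 3≤length (neighbour∈ ex) (neighbour∈ ey) (neighbour∈ ez)

↑ˡ≢↑ʳ : ∀ {k M} (x : Fin k) (s : Fin M) → ¬ x ↑ˡ M ≡ k ↑ʳ s
↑ˡ≢↑ʳ {k} {M} x s e with trans (sym (Fin.splitAt-↑ˡ k x M)) (trans (cong (splitAt k) e) (Fin.splitAt-↑ʳ k M s))
... | ()

-- The first k vertices are leaves, leaf x hanging off the base vertex f x.
attachLeaves : ∀ {M} → (Fin M → Fin M → Bool) → ∀ {k} → (Fin k → Fin M) → Fin (k + M) → Fin (k + M) → Bool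
attachLeaves adj {zero}  f = adj
attachLeaves adj {suc k} f = pendant (attachLeaves adj (f ∘ suc)) (k ↑ʳ f zero)

module _ {M : ℕ} (adj : Fin M → Fin M → Bool) where

  attachLeaves-isTree : ∀ {k} (f : Fin k → Fin M) → IsTree adj → IsTree (attachLeaves adj f)
  attachLeaves-isTree {zero}  f tree = tree
  attachLeaves-isTree {suc k} f tree = pendant-isTree _ _ (attachLeaves-isTree (f ∘ suc) tree)

  attachLeaves-base : ∀ {k} (f : Fin k → Fin M) s t → attachLeaves adj f (k ↑ʳ s) (k ↑ʳ t) ≡ adj s t
  attachLeaves-base {zero}  f s t = refl
  attachLeaves-base {suc k} f s t = attachLeaves-base (f ∘ suc) s t

  attachLeaves-leaf : ∀ {k} (f : Fin k → Fin M) x → attachLeaves adj f (x ↑ˡ M) (k ↑ʳ f x) ≡ true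
  attachLeaves-leaf {suc k} f zero    = dec-true ((k ↑ʳ f zero) ≟ (k ↑ʳ f zero)) refl
  attachLeaves-leaf {suc k} f (suc x) = attachLeaves-leaf (f ∘ suc) x

  attachLeaves-leaf-only : ∀ {k} (f : Fin k → Fin M) x {v} →
                           attachLeaves adj f (x ↑ˡ M) v ≡ true → v ≡ k ↑ʳ f x
  attachLeaves-leaf-only {suc k} f zero    {zero}  ()
  attachLeaves-leaf-only {suc k} f zero    {suc v} e = cong suc (≟-true⇒≡ e)
  attachLeaves-leaf-only {suc k} f (suc x) {zero}  e = ⊥-elim (↑ˡ≢↑ʳ x (f zero) (≟-true⇒≡ e))
  attachLeaves-leaf-only {suc k} f (suc x) {suc v} e = cong suc (attachLeaves-leaf-only (f ∘ suc) x e)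

  attachLeaves-walk : ∀ {k} (f : Fin k → Fin M) {s t p} → Walk adj s t p →
                      Walk (attachLeaves adj f) (k ↑ʳ s) (k ↑ʳ t) (map (k ↑ʳ_) p)
  attachLeaves-walk f here = here
  attachLeaves-walk f (step {u} {w} e r) = step (trans (attachLeaves-base f u w) e) (attachLeaves-walk f r)

↑ˡ-or-↑ʳ : ∀ {k M} (v : Fin (k + M)) → (∃ λ x → x ↑ˡ M ≡ v) ⊎ (∃ λ s → k ↑ʳ s ≡ v)
↑ˡ-or-↑ʳ {k} v with splitAt k v in eq
... | inj₁ x = inj₁ (x , Fin.splitAt⁻¹-↑ˡ eq)
... | inj₂ s = inj₂ (s , Fin.splitAt⁻¹-↑ʳ eq)

module LeafAttachment {M : ℕ} {adj : Fin M → Fin M → Bool} (tree : IsTree adj) {k : ℕ} (f : Fin k → Fin M) where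

  leaf : Fin k → Fin (k + M)
  leaf x = x ↑ˡ M

  base : Fin M → Fin (k + M)
  base s = k ↑ʳ s

  adj′ : Fin (k + M) → Fin (k + M) → Bool
  adj′ = attachLeaves adj f

  leafPath : Fin k → Fin k → List (Fin M) → List (Fin (k + M))
  leafPath a b p = leaf a ∷ (map base p ∷ʳ leaf b)

  leafPath-isPath : ∀ {a b p} → ¬ a ≡ b → IsPath adj (f a) (f b) p → IsPath adj′ (leaf a) (leaf b) (leafPath a b p)
  leafPath-isPath {a} {b} {p} a≢b (W , U) =
    step (attachLeaves-leaf adj f a)
         (walk-∷ʳ adj′ (attachLeaves-walk adj f W)
                  (trans (IsTree.adj-sym (attachLeaves-isTree adj f tree) (base (f b)) (leaf b)) (attachLeaves-leaf adj f b))) ,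
    Unique-∷ a∉ (Unique.++⁺ (Unique.map⁺ (Fin.↑ʳ-injective k _ _) U) ([] ∷ []) λ { (s∈ , here refl) → base≢b s∈ })
    where
    base≢b : leaf b ∉ map base p
    base≢b b∈ with ∈-map⁻ base b∈
    ... | s , _ , e = ↑ˡ≢↑ʳ b s e
    a∉ : leaf a ∉ map base p ∷ʳ leaf b
    a∉ a∈ with ∈-++⁻ (map base p) a∈
    ... | inj₁ a∈p with ∈-map⁻ base a∈p
    ...   | s , _ , e = ↑ˡ≢↑ʳ a s e
    a∉ a∈ | inj₂ (here e) = a≢b (Fin.↑ˡ-injective M a b e)

  ∈-leafPath : ∀ {a b p v} → v ∈ leafPath a b p →
               (∃ λ x → (x ≡ a ⊎ x ≡ b) × v ≡ leaf x) ⊎ (∃ λ s → s ∈ p × v ≡ base s)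
  ∈-leafPath (here refl) = inj₁ (_ , inj₁ refl , refl)
  ∈-leafPath {p = p} (there v∈) with ∈-++⁻ (map base p) v∈
  ... | inj₁ v∈p = inj₂ (∈-map⁻ base v∈p)
  ... | inj₂ (here refl) = inj₁ (_ , inj₂ refl , refl)

  attachLeaves-separated : ∀ (q : Quartet k) → Separated adj (f (a q)) (f (b q)) (f (c q)) (f (d q)) →
                           Separated adj′ (leaf (a q)) (leaf (b q)) (leaf (c q)) (leaf (d q))
  attachLeaves-separated q (p , p′ , P , P′ , p#p′) =
    leafPath (a q) (b q) p , leafPath (c q) (d q) p′ ,
    leafPath-isPath (a≢b q) P , leafPath-isPath (c≢d q) P′ ,
    λ v v∈ v∈′ → disjoint (∈-leafPath v∈) (∈-leafPath v∈′)
    where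
    distinct : ∀ {x y} → x ≡ a q ⊎ x ≡ b q → y ≡ c q ⊎ y ≡ d q → ¬ x ≡ y
    distinct (inj₁ refl) (inj₁ refl) = a≢c q
    distinct (inj₁ refl) (inj₂ refl) = a≢d q
    distinct (inj₂ refl) (inj₁ refl) = b≢c q
    distinct (inj₂ refl) (inj₂ refl) = b≢d q
    disjoint : ∀ {v} → (∃ λ x → (x ≡ a q ⊎ x ≡ b q) × v ≡ leaf x) ⊎ (∃ λ s → s ∈ p × v ≡ base s) →
               (∃ λ y → (y ≡ c q ⊎ y ≡ d q) × v ≡ leaf y) ⊎ (∃ λ s → s ∈ p′ × v ≡ base s) → ⊥
    disjoint (inj₁ (x , x∈ , refl)) (inj₁ (y , y∈ , e)) = distinct x∈ y∈ (Fin.↑ˡ-injective M x y e)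
    disjoint (inj₁ (x , _ , refl))  (inj₂ (s , _ , e))  = ↑ˡ≢↑ʳ x s e
    disjoint (inj₂ (s , _ , refl))  (inj₁ (y , _ , e))  = ↑ˡ≢↑ʳ y s (sym e)
    disjoint (inj₂ (s , s∈ , refl)) (inj₂ (t , t∈ , e)) =
      p#p′ s s∈ (subst (_∈ p′) (sym (Fin.↑ʳ-injective k s t e)) t∈)

  leaf-degree : ∀ x → degree adj′ (leaf x) ≡ 1
  leaf-degree x = degree≡1 adj′ (attachLeaves-leaf adj f x) (attachLeaves-leaf-only adj f x)

  leafTree : (∀ s → 3 ≤ degree adj′ (base s)) → PhyloTree k
  leafTree 3≤deg = record
    { m = k + M
    ; adj = adj′
    ; adj-sym = adj-sym
    ; adj-irrefl = adj-irrefl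
    ; connected = connected
    ; uniquePath = uniquePath
    ; noDeg2 = noDeg2
    ; leaf = leaf
    ; leaf-inj = Fin.↑ˡ-injective M
    ; leaf-deg = leaf-degree
    ; leaf-surj = leaf-surj
    }
    where
    open IsTree (attachLeaves-isTree adj f tree)
    noDeg2 : ∀ v → ¬ degree adj′ v ≡ 2
    noDeg2 v deg≡2 with ↑ˡ-or-↑ʳ {k} {M} v
    ... | inj₁ (x , refl) = ℕ.1+n≢n (sym (trans (sym (leaf-degree x)) deg≡2))
    ... | inj₂ (s , refl) = ℕ.<⇒≢ (3≤deg s) (sym deg≡2)
    leaf-surj : ∀ v → degree adj′ v ≡ 1 → ∃ λ x → leaf x ≡ v
    leaf-surj v deg≡1 with ↑ˡ-or-↑ʳ {k} {M} v
    ... | inj₁ leafv = leafv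
    ... | inj₂ (s , refl) = ⊥-elim (ℕ.<⇒≢ (ℕ.≤-trans (ℕ.n≤1+n 2) (3≤deg s)) (sym deg≡1))

spine : (R : ℕ) → Fin (suc R) → Fin (suc R) → Bool
spine zero    _ _ = false
spine (suc R) = pendant (spine R) zero

spine-isTree : ∀ R → IsTree (spine R)
spine-isTree zero = record
  { adj-sym = λ _ _ → refl
  ; adj-irrefl = λ _ → refl
  ; connected = λ { zero zero → _ , here , [] ∷ [] }
  ; uniquePath = unique
  }
  where
  unique : ∀ u v p q → IsPath (spine zero) u v p → IsPath (spine zero) u v q → p ≡ q
  unique zero zero _ _ (here , _)     (here , _)     = refl
  unique zero zero _ _ (step () _ , _) _
  unique zero zero _ _ _              (step () _ , _)
spine-isTree (suc R) = pendant-isTree (spine R) zero (spine-isTree R)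

spine-step : ∀ R (t : Fin (suc R)) → spine (suc R) (inject₁ t) (suc t) ≡ true
spine-step R       zero    = refl
spine-step (suc R) (suc t) = spine-step R t

spine-step-down : ∀ R (t : Fin (suc R)) → spine (suc R) (suc t) (inject₁ t) ≡ true
spine-step-down R t = trans (IsTree.adj-sym (spine-isTree (suc R)) (suc t) (inject₁ t)) (spine-step R t)

private
  ∈-map-suc-bounds : ∀ {n} {p : List (Fin n)} {lo hi} → (∀ {x} → x ∈ p → lo ≤ toℕ x × toℕ x ≤ hi) →
                     ∀ {x} → x ∈ map suc p → suc lo ≤ toℕ x × toℕ x ≤ suc hi
  ∈-map-suc-bounds bounds x∈ with ∈-map⁻ suc x∈
  ... | _ , x₀∈p , refl = map-× s≤s s≤s (bounds x₀∈p)

spine-ascent : ∀ {R} (s t : Fin (suc R)) → toℕ s ≤ toℕ t →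
               ∃ λ p → IsPath (spine R) s t p × (∀ {x} → x ∈ p → toℕ s ≤ toℕ x × toℕ x ≤ toℕ t)
spine-ascent {zero}  zero    zero    _ = _ , (here , [] ∷ []) , λ { (here refl) → z≤n , z≤n }
spine-ascent {suc R} zero    zero    _ = _ , (here , [] ∷ []) , λ { (here refl) → z≤n , z≤n }
spine-ascent {suc R} zero    (suc t) _ with spine-ascent zero t z≤n
... | _ , P , bounds = _ , pendant-path-new (spine R) zero P , λ
  { (here refl) → z≤n , z≤n
  ; (there x∈) → z≤n , proj₂ (∈-map-suc-bounds bounds x∈) }
spine-ascent {suc R} (suc s) (suc t) (s≤s s≤t) with spine-ascent s t s≤t
... | _ , P , bounds = _ , pendant-path (spine R) zero P , ∈-map-suc-bounds bounds

spine-path : ∀ {R} (s t : Fin (suc R)) →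
             ∃ λ p → IsPath (spine R) s t p × (∀ {x} → x ∈ p → toℕ s ⊓ toℕ t ≤ toℕ x × toℕ x ≤ toℕ s ⊔ toℕ t)
spine-path {R} s t with toℕ s ℕ.≤? toℕ t
... | yes s≤t = let p , P , bounds = spine-ascent s t s≤t in p , P , λ x∈ →
  let s≤x , x≤t = bounds x∈ in ℕ.≤-trans (ℕ.m⊓n≤m _ _) s≤x , ℕ.≤-trans x≤t (ℕ.m≤n⊔m _ _)
... | no s≰t = let p , P , bounds = spine-ascent t s (ℕ.≰⇒≥ s≰t) in
  reverse p , path-reverse (spine R) (IsTree.adj-sym (spine-isTree R)) P , λ x∈ →
  let t≤x , x≤s = bounds (Any.reverse⁻ x∈) in ℕ.≤-trans (ℕ.m⊓n≤n _ _) t≤x , ℕ.≤-trans x≤s (ℕ.m≤m⊔n _ _)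

spine-separated : ∀ {R} {s t s′ t′ : Fin (suc R)} → toℕ s ⊔ toℕ t < toℕ s′ ⊓ toℕ t′ →
                  Separated (spine R) s t s′ t′
spine-separated {s = s} {t} {s′} {t′} st<s′t′ with spine-path s t | spine-path s′ t′
... | p , P , p-bounds | p′ , P′ , p′-bounds = p , p′ , P , P′ , λ v v∈p v∈p′ →
  ℕ.<-irrefl refl (ℕ.≤-<-trans (proj₂ (p-bounds v∈p)) (ℕ.<-≤-trans st<s′t′ (proj₁ (p′-bounds v∈p′))))

inject₁≢suc : ∀ {n} (x : Fin n) → ¬ inject₁ x ≡ suc x
inject₁≢suc (suc x) e = inject₁≢suc x (Fin.suc-injective e)

inject₁²≢suc² : ∀ {n} (x : Fin n) → ¬ inject₁ (inject₁ x) ≡ suc (suc x)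
inject₁²≢suc² (suc x) e = inject₁²≢suc² x (Fin.suc-injective e)

fromℕ-or-inject₁ : ∀ {n} (t : Fin (suc n)) → t ≡ fromℕ n ⊎ ∃ λ u → t ≡ inject₁ u
fromℕ-or-inject₁ {zero}  zero    = inj₁ refl
fromℕ-or-inject₁ {suc n} zero    = inj₂ (zero , refl)
fromℕ-or-inject₁ {suc n} (suc t) with fromℕ-or-inject₁ t
... | inj₁ refl       = inj₁ refl
... | inj₂ (u , refl) = inj₂ (suc u , refl)

1≤⊔ : ∀ {n} {x y : Fin n} → ¬ x ≡ y → 1 ≤ toℕ x ⊔ toℕ y
1≤⊔ {x = zero}  {zero}  x≢y = ⊥-elim (x≢y refl)
1≤⊔ {x = zero}  {suc y} _   = s≤s z≤n
1≤⊔ {x = suc x} {y}     _   = ℕ.≤-trans (s≤s z≤n) (ℕ.m≤m⊔n (suc (toℕ x)) (toℕ y))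

⊓<pred : ∀ {n} {x y : Fin (suc n)} → ¬ x ≡ y → toℕ x ⊓ toℕ y < n
⊓<pred {x = zero}  {zero}  x≢y = ⊥-elim (x≢y refl)
⊓<pred {suc n} {x = zero}  {suc y} _ = s≤s z≤n
⊓<pred {suc n} {x = suc x} {zero}  _ = s≤s z≤n
⊓<pred {suc n} {x = suc x} {suc y} x≢y = s≤s (⊓<pred (x≢y ∘ cong suc))

clamp : ∀ {R} → Fin (2 + R) → Fin (1 + R)
clamp {zero}  _       = zero
clamp {suc R} zero    = zero
clamp {suc R} (suc p) = suc (clamp p)

-- Positions 0 … R + 2 hang off the spine vertices 0, 0, 1, …, R − 1, R, R.
hook : ∀ {R} → Fin (3 + R) → Fin (1 + R)
hook zero    = zero
hook (suc p) = clamp p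

toℕ-clamp : ∀ {R} (p : Fin (2 + R)) → toℕ (clamp p) ≡ toℕ p ⊓ R
toℕ-clamp {zero}  p       = sym (ℕ.⊓-zeroʳ (toℕ p))
toℕ-clamp {suc R} zero    = refl
toℕ-clamp {suc R} (suc p) = cong suc (toℕ-clamp p)

hookℕ : ℕ → ℕ → ℕ
hookℕ R p = (p ∸ 1) ⊓ R

toℕ-hook : ∀ {R} (p : Fin (3 + R)) → toℕ (hook p) ≡ hookℕ R (toℕ p)
toℕ-hook zero    = refl
toℕ-hook (suc p) = toℕ-clamp p

hookℕ-mono : ∀ R {p p′} → p ≤ p′ → hookℕ R p ≤ hookℕ R p′
hookℕ-mono R p≤p′ = ℕ.⊓-monoˡ-≤ R (ℕ.∸-monoˡ-≤ 1 p≤p′)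

hookℕ-< : ∀ R {p p′} → 1 ≤ p → p < p′ → p′ ≤ suc R → hookℕ R p < hookℕ R p′
hookℕ-< R {suc p} {suc p′} _ (s≤s p<p′) (s≤s p′≤R) =
  ℕ.≤-<-trans (ℕ.m⊓n≤m p R) (subst (p <_) (sym (ℕ.m≤n⇒m⊓n≡m p′≤R)) p<p′)

hook-separates : ∀ {R} {x y z w : Fin (3 + R)} → ¬ x ≡ y → ¬ z ≡ w → toℕ x ⊔ toℕ y < toℕ z ⊓ toℕ w →
                 toℕ (hook x) ⊔ toℕ (hook y) < toℕ (hook z) ⊓ toℕ (hook w)
hook-separates {R} {x} {y} {z} {w} x≢y z≢w xy<zw = begin-strict
  toℕ (hook x) ⊔ toℕ (hook y)          ≡⟨ cong₂ _⊔_ (toℕ-hook x) (toℕ-hook y) ⟩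
  hookℕ R (toℕ x) ⊔ hookℕ R (toℕ y)    ≡⟨ ℕ.mono-≤-distrib-⊔ (hookℕ-mono R) (toℕ x) (toℕ y) ⟨
  hookℕ R (toℕ x ⊔ toℕ y)              <⟨ hookℕ-< R (1≤⊔ x≢y) xy<zw (ℕ.≤-pred (⊓<pred z≢w)) ⟩
  hookℕ R (toℕ z ⊓ toℕ w)              ≡⟨ ℕ.mono-≤-distrib-⊓ (hookℕ-mono R) (toℕ z) (toℕ w) ⟩
  hookℕ R (toℕ z) ⊓ hookℕ R (toℕ w)    ≡⟨ cong₂ _⊓_ (toℕ-hook z) (toℕ-hook w) ⟨
  toℕ (hook z) ⊓ toℕ (hook w)          ∎
  where open ℕ.≤-Reasoning

clamp-inject₁ : ∀ {R} (s : Fin (1 + R)) → clamp (inject₁ s) ≡ s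
clamp-inject₁ {zero}  zero    = refl
clamp-inject₁ {suc R} zero    = refl
clamp-inject₁ {suc R} (suc s) = cong suc (clamp-inject₁ s)

clamp-fromℕ : ∀ R → clamp (fromℕ (suc R)) ≡ fromℕ R
clamp-fromℕ zero    = refl
clamp-fromℕ (suc R) = cong suc (clamp-fromℕ R)

module Caterpillar (R : ℕ) where

  open LeafAttachment (spine-isTree (suc R)) (hook {suc R})

  private
    base~leaf : ∀ x {s} → hook x ≡ s → adj′ (base s) (leaf x) ≡ true
    base~leaf x refl =
      trans (IsTree.adj-sym (attachLeaves-isTree (spine (suc R)) hook (spine-isTree (suc R))) (base (hook x)) (leaf x))
            (attachLeaves-leaf (spine (suc R)) hook x)

    base~base : ∀ s t → spine (suc R) s t ≡ true → adj′ (base s) (base t) ≡ true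
    base~base s t = trans (attachLeaves-base (spine (suc R)) hook s t)

    leaf≢leaf : ∀ {x y} → ¬ x ≡ y → ¬ leaf x ≡ leaf y
    leaf≢leaf x≢y = x≢y ∘ Fin.↑ˡ-injective _ _ _

    base≢base : ∀ {s t} → ¬ s ≡ t → ¬ base s ≡ base t
    base≢base s≢t = s≢t ∘ Fin.↑ʳ-injective _ _ _

    leaf≢base : ∀ {x s} → ¬ leaf x ≡ base s
    leaf≢base = ↑ˡ≢↑ʳ _ _

  -- Every spine vertex s carries the leaf at position s + 1 and has a further neighbour on each side:
  -- a spine vertex, or at the two ends the leaf at the outermost position.
  3≤degree-base : ∀ s → 3 ≤ degree adj′ (base s)
  3≤degree-base zero =
    3≤degree adj′ (base zero) (leaf zero) (leaf (suc zero)) (base (suc zero))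
              (base~leaf zero refl) (base~leaf (suc zero) refl)
              (base~base zero (suc zero) (spine-step R zero))
              (leaf≢leaf λ ()) leaf≢base leaf≢base
  3≤degree-base (suc t) with fromℕ-or-inject₁ t
  ... | inj₁ refl =
    3≤degree adj′ (base (suc (fromℕ R)))
              (leaf (suc (suc (inject₁ (fromℕ R))))) (leaf (suc (suc (suc (fromℕ R))))) (base (inject₁ (fromℕ R)))
              (base~leaf (suc (suc (inject₁ (fromℕ R)))) (cong suc (clamp-inject₁ (fromℕ R))))
              (base~leaf (suc (suc (suc (fromℕ R)))) (cong suc (clamp-fromℕ R)))
              (base~base (suc (fromℕ R)) (inject₁ (fromℕ R)) (spine-step-down R (fromℕ R)))
              (leaf≢leaf (inject₁≢suc (fromℕ R) ∘ Fin.suc-injective ∘ Fin.suc-injective)) leaf≢base leaf≢base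
  ... | inj₂ (u , refl) =
    3≤degree adj′ (base (suc (inject₁ u)))
              (leaf (suc (suc (inject₁ (inject₁ u))))) (base (inject₁ (inject₁ u))) (base (suc (suc u)))
              (base~leaf (suc (suc (inject₁ (inject₁ u)))) (cong suc (clamp-inject₁ (inject₁ u))))
              (base~base (suc (inject₁ u)) (inject₁ (inject₁ u)) (spine-step-down R (inject₁ u)))
              (base~base (suc (inject₁ u)) (suc (suc u)) (spine-step R (suc u)))
              leaf≢base leaf≢base (base≢base (inject₁²≢suc² u))

  caterpillar : PhyloTree (4 + R)
  caterpillar = leafTree 3≤degree-base

  caterpillar-displays : ∀ (q : Quartet (4 + R)) → toℕ (a q) ⊔ toℕ (b q) < toℕ (c q) ⊓ toℕ (d q) →
                         Displays caterpillar q
  caterpillar-displays q ab<cd =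
    attachLeaves-separated q (spine-separated (hook-separates (a≢b q) (c≢d q) ab<cd))

⟨$⟩ʳ-injective : ∀ {n} (π : Permutation′ n) {x y} → π ⟨$⟩ʳ x ≡ π ⟨$⟩ʳ y → x ≡ y
⟨$⟩ʳ-injective π e = trans (sym (inverseˡ π)) (trans (cong (π ⟨$⟩ˡ_) e) (inverseˡ π))

relabel : ∀ {n} → PhyloTree n → Permutation′ n → PhyloTree n
relabel T π = record T
  { leaf = leaf ∘ (π ⟨$⟩ʳ_)
  ; leaf-inj = λ x y e → ⟨$⟩ʳ-injective π (leaf-inj _ _ e)
  ; leaf-deg = leaf-deg ∘ (π ⟨$⟩ʳ_)
  ; leaf-surj = λ v deg≡1 → let x , leafx≡v = leaf-surj v deg≡1 in
                            π ⟨$⟩ˡ x , trans (cong leaf (inverseʳ π)) leafx≡v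
  }
  where open PhyloTree T

permuteQuartet : ∀ {n} → Permutation′ n → Quartet n → Quartet n
permuteQuartet π q = record
  { a = π ⟨$⟩ʳ a q ; b = π ⟨$⟩ʳ b q ; c = π ⟨$⟩ʳ c q ; d = π ⟨$⟩ʳ d q
  ; a≢b = a≢b q ∘ ⟨$⟩ʳ-injective π ; a≢c = a≢c q ∘ ⟨$⟩ʳ-injective π ; a≢d = a≢d q ∘ ⟨$⟩ʳ-injective π
  ; b≢c = b≢c q ∘ ⟨$⟩ʳ-injective π ; b≢d = b≢d q ∘ ⟨$⟩ʳ-injective π ; c≢d = c≢d q ∘ ⟨$⟩ʳ-injective π
  }

module RestrictToFin {n : ℕ} (f g : ℕ → ℕ) (f< : ∀ {x} → x < n → f x < n) (g< : ∀ {x} → x < n → g x < n)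
         (g∘f : ∀ x → g (f x) ≡ x) (f∘g : ∀ x → f (g x) ≡ x) where

  restriction : Permutation′ n
  restriction = permutation to from to∘from from∘to
    where
    to from : Fin n → Fin n
    to x = fromℕ< (f< (Fin.toℕ<n x))
    from y = fromℕ< (g< (Fin.toℕ<n y))
    open ≡-Reasoning
    to∘from : ∀ y → to (from y) ≡ y
    to∘from y = Fin.toℕ-injective (begin
      toℕ (to (from y))  ≡⟨ Fin.toℕ-fromℕ< _ ⟩
      f (toℕ (from y))   ≡⟨ cong f (Fin.toℕ-fromℕ< _) ⟩
      f (g (toℕ y))      ≡⟨ f∘g (toℕ y) ⟩
      toℕ y              ∎)
    from∘to : ∀ x → from (to x) ≡ x
    from∘to x = Fin.toℕ-injective (begin
      toℕ (from (to x))  ≡⟨ Fin.toℕ-fromℕ< _ ⟩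
      g (toℕ (to x))     ≡⟨ cong g (Fin.toℕ-fromℕ< _) ⟩
      g (f (toℕ x))      ≡⟨ g∘f (toℕ x) ⟩
      toℕ x              ∎)

  toℕ-restriction : ∀ x → toℕ (restriction ⟨$⟩ʳ x) ≡ f (toℕ x)
  toℕ-restriction x = Fin.toℕ-fromℕ< (f< (Fin.toℕ<n x))

shiftPast : ℕ → ℕ → ℕ
shiftPast i       zero    = zero
shiftPast zero    (suc j) = 3 + j
shiftPast (suc i) (suc j) = suc (shiftPast i j)

shiftPast-≤ : ∀ {i j} → j ≤ i → shiftPast i j ≡ j
shiftPast-≤ z≤n = refl
shiftPast-≤ (s≤s j≤i) = cong suc (shiftPast-≤ j≤i)

shiftPast-> : ∀ {i j} → i < j → shiftPast i j ≡ 2 + j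
shiftPast-> {zero} (s≤s z≤n) = refl
shiftPast-> {suc i} (s≤s i<j) = cong suc (shiftPast-> i<j)

shiftPast≤ : ∀ i j → shiftPast i j ≤ 2 + j
shiftPast≤ i       zero    = z≤n
shiftPast≤ zero    (suc j) = ℕ.≤-refl
shiftPast≤ (suc i) (suc j) = s≤s (shiftPast≤ i j)

-- The cyclic shift of 0, 1, …, i + 2 by two places: 2, …, i + 2 go to 0, …, i and 0, 1 to i + 1, i + 2.
rotate : ℕ → ℕ → ℕ
rotate i zero          = suc i
rotate i (suc zero)    = 2 + i
rotate i (suc (suc j)) = shiftPast i j

punchIn2 : ℕ → ℕ
punchIn2 zero          = zero
punchIn2 (suc zero)    = suc zero
punchIn2 (suc (suc q)) = 3 + q

unrotate : ℕ → ℕ → ℕ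
unrotate zero    zero                = 2
unrotate zero    (suc zero)          = 0
unrotate zero    (suc (suc zero))    = 1
unrotate zero    (suc (suc (suc p))) = 3 + p
unrotate (suc i) zero                = 2
unrotate (suc i) (suc p)             = punchIn2 (unrotate i p)

rotate-punchIn2 : ∀ i q → rotate (suc i) (punchIn2 q) ≡ suc (rotate i q)
rotate-punchIn2 i zero          = refl
rotate-punchIn2 i (suc zero)    = refl
rotate-punchIn2 i (suc (suc q)) = refl

rotate-unrotate : ∀ i p → rotate i (unrotate i p) ≡ p
rotate-unrotate zero    zero                = refl
rotate-unrotate zero    (suc zero)          = refl
rotate-unrotate zero    (suc (suc zero))    = refl
rotate-unrotate zero    (suc (suc (suc p))) = refl
rotate-unrotate (suc i) zero                = refl
rotate-unrotate (suc i) (suc p)             =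
  trans (rotate-punchIn2 i (unrotate i p)) (cong suc (rotate-unrotate i p))

unrotate-rotate : ∀ i x → unrotate i (rotate i x) ≡ x
unrotate-rotate zero    zero                = refl
unrotate-rotate zero    (suc zero)          = refl
unrotate-rotate zero    (suc (suc zero))    = refl
unrotate-rotate zero    (suc (suc (suc j))) = refl
unrotate-rotate (suc i) zero                = cong punchIn2 (unrotate-rotate i 0)
unrotate-rotate (suc i) (suc zero)          = cong punchIn2 (unrotate-rotate i 1)
unrotate-rotate (suc i) (suc (suc zero))    = refl
unrotate-rotate (suc i) (suc (suc (suc j))) = cong punchIn2 (unrotate-rotate i (2 + j))

rotate-< : ∀ {i n x} → 3 + i ≤ n → x < n → rotate i x < n
rotate-< {x = zero}          3+i≤n _   = ℕ.≤-trans (ℕ.n≤1+n _) 3+i≤n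
rotate-< {x = suc zero}      3+i≤n _   = 3+i≤n
rotate-< {i} {x = suc (suc j)} _   x<n = ℕ.≤-<-trans (shiftPast≤ i j) x<n

unrotate-< : ∀ {i n p} → 3 + i ≤ n → p < n → unrotate i p < n
unrotate-< {zero}  {p = zero}                3≤n _   = 3≤n
unrotate-< {zero}  {p = suc zero}            3≤n _   = ℕ.≤-trans (s≤s z≤n) 3≤n
unrotate-< {zero}  {p = suc (suc zero)}      3≤n _   = ℕ.≤-trans (s≤s (s≤s z≤n)) 3≤n
unrotate-< {zero}  {p = suc (suc (suc p))}   _   p<n = p<n
unrotate-< {suc i} {p = zero}                4+i≤n _ = ℕ.≤-trans (s≤s (s≤s (s≤s z≤n))) 4+i≤n
unrotate-< {suc i} {p = suc p} (s≤s 3+i≤n) (s≤s p<n) =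
  ℕ.≤-trans (s≤s (punchIn2≤ (unrotate i p))) (s≤s (unrotate-< 3+i≤n p<n))
  where
  punchIn2≤ : ∀ q → punchIn2 q ≤ suc q
  punchIn2≤ zero          = z≤n
  punchIn2≤ (suc zero)    = s≤s z≤n
  punchIn2≤ (suc (suc q)) = ℕ.≤-refl

before : ∀ {x y z w} → x < z → x < w → y < z → y < w → x ⊔ y < z ⊓ w
before x<z x<w y<z y<w = ℕ.⊓-glb (ℕ.⊔-lub x<z y<z) (ℕ.⊔-lub x<w y<w)

consecutive-before : ∀ {x y} → suc x < y → x ⊔ suc x < y ⊓ suc y
consecutive-before {x} {y} 1+x<y = before (ℕ.<-trans (ℕ.n<1+n x) 1+x<y) (ℕ.<-trans (ℕ.n<1+n x) (ℕ.m<n⇒m<1+n 1+x<y))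
                                          1+x<y (ℕ.m<n⇒m<1+n 1+x<y)

module Quartets (K : ℕ) where

  z ℓ : Fin (4 + K)
  z = zero
  ℓ = suc zero

  chain : Fin (2 + K) → Fin (4 + K)
  chain j = suc (suc j)

  link : Fin (1 + K) → Quartet (4 + K)
  link j = record
    { a = chain (inject₁ j) ; b = chain (suc j) ; c = z ; d = ℓ
    ; a≢b = inject₁≢suc j ∘ Fin.suc-injective ∘ Fin.suc-injective
    ; a≢c = λ () ; a≢d = λ () ; b≢c = λ () ; b≢d = λ () ; c≢d = λ ()
    }

  star : Quartet (4 + K)
  star = record
    { a = chain zero ; b = z ; c = chain (fromℕ (suc K)) ; d = ℓ
    ; a≢b = λ () ; a≢c = λ () ; a≢d = λ () ; b≢c = λ () ; b≢d = λ () ; c≢d = λ ()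
    }

  Q : List (Quartet (4 + K))
  Q = star ∷ tabulate link

  link∈Q : ∀ j → link j ∈ Q
  link∈Q j = there (∈-tabulate⁺ {f = link} j)

  Q-distinct : AllPairs (λ q q′ → ¬ SameQuartet q q′) Q
  Q-distinct = All.tabulate⁺ {f = link} star≢link ∷ AllPairs.tabulate⁺ {f = link} link≢link
    where
    star≢link : ∀ j → ¬ SameQuartet star (link j)
    star≢link j (inj₁ (inj₁ (_ , ()) , _))
    star≢link j (inj₁ (inj₂ (_ , ()) , _))
    star≢link j (inj₂ (inj₁ (() , _) , _))
    star≢link j (inj₂ (inj₂ (() , _) , _))
    link≢link : ∀ {j j′} → ¬ j ≡ j′ → ¬ SameQuartet (link j) (link j′)
    link≢link j≢j′ (inj₁ (inj₁ (e , _) , _)) = j≢j′ (Fin.inject₁-injective (Fin.suc-injective (Fin.suc-injective e)))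
    link≢link {suc j} {j′} _ (inj₁ (inj₂ (e , e′) , _))
      with Fin.suc-injective (Fin.suc-injective (Fin.suc-injective e))
    ... | refl = inject₁²≢suc² j (sym (Fin.suc-injective (Fin.suc-injective e′)))
    link≢link _ (inj₂ (inj₁ (() , _) , _))
    link≢link _ (inj₂ (inj₂ (() , _) , _))

  Q-covers : ∀ x → ∃ λ q → q ∈ Q × x ∈ℒ q
  Q-covers zero                   = star , here refl , inj₂ (inj₁ refl)
  Q-covers (suc zero)             = star , here refl , inj₂ (inj₂ (inj₂ refl))
  Q-covers (suc (suc zero))       = star , here refl , inj₁ refl
  Q-covers (suc (suc (suc j)))    = link j , link∈Q j , inj₂ (inj₁ refl)

  ℓ∈Q : ∀ q → q ∈ Q → ℓ ∈ℒ q
  ℓ∈Q q (here refl) = inj₂ (inj₂ (inj₂ refl))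
  ℓ∈Q q (there q∈) with ∈-tabulate⁻ {f = link} q∈
  ... | _ , refl = inj₂ (inj₂ (inj₂ refl))

  Q-incompatible : ¬ Compatible (λ q → q ∈ Q)
  Q-incompatible (T , displays) = separated⇒¬crossed (chain-separated (fromℕ K)) (displays star (here refl))
    where
    open PhyloTree T
    open TreeProperties (PhyloTree⇒IsTree T)
    ChainSeparated : Fin (1 + K) → Set
    ChainSeparated j = Separated adj (leaf (chain zero)) (leaf (chain (suc j))) (leaf z) (leaf ℓ)
    chain-separated : ∀ j → ChainSeparated j
    chain-separated = <-weakInduction ChainSeparated (displays (link zero) (link∈Q zero))
      (λ j sep → separated-trans sep (displays (link (suc j)) (link∈Q (suc j))))

  Q-length : length Q ≡ 2 + K
  Q-length = cong suc (length-tabulate link)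

  -- For i ≤ K + 1, the caterpillar with leaf order c₀, …, cᵢ, z, ℓ, c_{i+1}, …, c_{K+1}.
  module Order (i : ℕ) (i≤1+K : i ≤ suc K) =
    RestrictToFin (rotate i) (unrotate i) (rotate-< (s≤s (s≤s (s≤s i≤1+K)))) (unrotate-< (s≤s (s≤s (s≤s i≤1+K))))
                  (unrotate-rotate i) (rotate-unrotate i)

  tree : ∀ i → i ≤ suc K → PhyloTree (4 + K)
  tree i i≤1+K = relabel (Caterpillar.caterpillar K) (Order.restriction i i≤1+K)

  tree-displays : ∀ i i≤1+K q →
                  rotate i (toℕ (a q)) ⊔ rotate i (toℕ (b q)) < rotate i (toℕ (c q)) ⊓ rotate i (toℕ (d q)) →
                  Displays (tree i i≤1+K) q
  -- Displays (relabel T π) q is by definition Displays T (permuteQuartet π q).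
  tree-displays i i≤1+K q ab<cd = Caterpillar.caterpillar-displays K (permuteQuartet π q) (begin-strict
    toℕ (π ⟨$⟩ʳ a q) ⊔ toℕ (π ⟨$⟩ʳ b q)                ≡⟨ cong₂ _⊔_ (position (a q)) (position (b q)) ⟩
    rotate i (toℕ (a q)) ⊔ rotate i (toℕ (b q))        <⟨ ab<cd ⟩
    rotate i (toℕ (c q)) ⊓ rotate i (toℕ (d q))        ≡⟨ cong₂ _⊓_ (position (c q)) (position (d q)) ⟨
    toℕ (π ⟨$⟩ʳ c q) ⊓ toℕ (π ⟨$⟩ʳ d q)                ∎)
    where
    open ℕ.≤-Reasoning
    π : Permutation′ (4 + K)
    π = Order.restriction i i≤1+K
    position : ∀ x → toℕ (π ⟨$⟩ʳ x) ≡ rotate i (toℕ x)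
    position = Order.toℕ-restriction i i≤1+K

  tree-displays-link : ∀ i i≤1+K j → ¬ toℕ j ≡ i → Displays (tree i i≤1+K) (link j)
  tree-displays-link i i≤1+K j j≢i with ℕ.<-cmp (toℕ j) i
  ... | tri≈ _ j≡i _ = ⊥-elim (j≢i j≡i)
  ... | tri< j<i _ _ = tree-displays i i≤1+K (link j) (begin-strict
    shiftPast i (toℕ (inject₁ j)) ⊔ shiftPast i (suc (toℕ j))
      ≡⟨ cong₂ _⊔_ (trans (cong (shiftPast i) (Fin.toℕ-inject₁ j)) (shiftPast-≤ (ℕ.<⇒≤ j<i))) (shiftPast-≤ j<i) ⟩
    toℕ j ⊔ suc (toℕ j)                                        <⟨ consecutive-before (s≤s j<i) ⟩
    suc i ⊓ suc (suc i)                                        ∎)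
    where open ℕ.≤-Reasoning
  ... | tri> _ _ i<j = displays-swapSides (tree i i≤1+K) (link j) (tree-displays i i≤1+K (swapSides (link j)) (begin-strict
    suc i ⊔ suc (suc i)                                        <⟨ consecutive-before (s≤s (s≤s i<j)) ⟩
    suc (suc (toℕ j)) ⊓ suc (suc (suc (toℕ j)))
      ≡⟨ cong₂ _⊓_ (trans (cong (shiftPast i) (Fin.toℕ-inject₁ j)) (shiftPast-> i<j)) (shiftPast-> (ℕ.m<n⇒m<1+n i<j)) ⟨
    shiftPast i (toℕ (inject₁ j)) ⊓ shiftPast i (suc (toℕ j))  ∎))
    where open ℕ.≤-Reasoning

  tree-displays-star : ∀ i i≤1+K → i ≤ K → Displays (tree i i≤1+K) star
  tree-displays-star i i≤1+K i≤K = tree-displays i i≤1+K star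
    (subst (λ p → suc i < p ⊓ suc (suc i)) (sym last-position)
           (before (s≤s z≤n) (s≤s z≤n) (s≤s (s≤s (ℕ.m≤n⇒m≤1+n i≤K))) (ℕ.n<1+n (suc i))))
    where
    last-position : shiftPast i (toℕ (fromℕ (suc K))) ≡ 3 + K
    last-position = trans (cong (shiftPast i) (Fin.toℕ-fromℕ (suc K))) (shiftPast-> (s≤s i≤K))

  all-but-one : ∀ {q₀} → q₀ ∈ Q → Σ (PhyloTree (4 + K)) λ T → ∀ {q} → q ∈ Q → ¬ q ≡ q₀ → Displays T q
  all-but-one (here refl) = tree (suc K) ℕ.≤-refl , displays
    where
    displays : ∀ {q} → q ∈ Q → ¬ q ≡ star → Displays (tree (suc K) ℕ.≤-refl) q
    displays (here refl) q≢star = ⊥-elim (q≢star refl)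
    displays (there q∈) _ with ∈-tabulate⁻ {f = link} q∈
    ... | j , refl = tree-displays-link (suc K) ℕ.≤-refl j (ℕ.<⇒≢ (Fin.toℕ<n j))
  all-but-one (there q₀∈) with ∈-tabulate⁻ {f = link} q₀∈
  ... | i , refl = tree (toℕ i) i≤1+K , displays
    where
    i≤1+K : toℕ i ≤ suc K
    i≤1+K = ℕ.<⇒≤ (Fin.toℕ<n i)
    displays : ∀ {q} → q ∈ Q → ¬ q ≡ link i → Displays (tree (toℕ i) i≤1+K) q
    displays (here refl) _ = tree-displays-star (toℕ i) i≤1+K (ℕ.≤-pred (Fin.toℕ<n i))
    displays (there q∈) q≢ with ∈-tabulate⁻ {f = link} q∈
    ... | j , refl = tree-displays-link (toℕ i) i≤1+K j (q≢ ∘ cong link ∘ Fin.toℕ-injective)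

  Q-minimal : ∀ (S : Quartet (4 + K) → Set) → (∀ q → S q → q ∈ Q) → (∃ λ q → q ∈ Q × ¬ S q) → Compatible S
  Q-minimal S S⊆Q (q₀ , q₀∈Q , ¬Sq₀) with all-but-one q₀∈Q
  ... | T , displays = T , λ q Sq → displays (S⊆Q q Sq) λ { refl → ¬Sq₀ Sq }

theorem8 : ∀ n → 4 ≤ n →
    Σ (List (Quartet n)) λ Q → Σ (Fin n) λ ℓ →
      AllPairs (λ q q' → ¬ SameQuartet q q') Q
      × (∀ x → ∃ λ q → q ∈ Q × x ∈ℒ q)
      × (∀ q → q ∈ Q → ℓ ∈ℒ q)
      × ¬ Compatible (λ q → q ∈ Q)
      × (∀ (S : Quartet n → Set) → (∀ q → S q → q ∈ Q) → (∃ λ q → q ∈ Q × ¬ S q) → Compatible S)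
      × length Q ≡ n ∸ 2
theorem8 (suc (suc (suc (suc K)))) (s≤s (s≤s (s≤s (s≤s z≤n)))) =
  Q , ℓ , Q-distinct , Q-covers , ℓ∈Q , Q-incompatible , Q-minimal , Q-length
  where open Quartets K
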